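{- For every function $f:\omega\to\omega$, the linear ordering $Z_f=\sum_{i\in\omega}(\zeta+f(i))$ is not weakly sp-homogeneous.
   Context: $\zeta$ is the order type of the integers and $f(i)$ denotes a finite linear order with $f(i)$ elements. $s(x)$ is the immediate successor of $x$ if it exists and $s(x)=x$ otherwise; $p(x)$ likewise for predecessors. $L$ is weakly sp-homogeneous if there is a finite set of elements $a_1,\dots,a_n$ such that every isomorphism between finitely generated substructures of $(L,<,s,p)$ that maps each $a_i$ to itself extends to an automorphism of $(L,<,s,p)$. -}

module Defs where

open import Data.Nat as ℕ using (ℕ)
open import Data.Integer as ℤ using (ℤ)
open import Data.Fin as Fin using (Fin)
open import Data.Sum using (_⊎_; inj₁; inj₂)
open import Data.Product using (Σ; _×_; _,_; ∃; ∃-syntax)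
open import Data.List using (List)
open import Data.List.Membership.Propositional using (_∈_)
open import Relation.Nullary using (¬_)
open import Relation.Binary.PropositionalEquality using (_≡_)
open import Function.Definitions using (Bijective)
open import Function.Bundles using (_⇔_)

module _ {L : Set} (_<_ : L → L → Set) where

  ImmSucc : L → L → Set
  ImmSucc x y = (x < y) × (∀ z → ¬ ((x < z) × (z < y)))

  -- graph of s: s(x) = immediate successor if it exists, else x
  SRel : L → L → Set
  SRel x y = ImmSucc x y ⊎ ((∀ z → ¬ ImmSucc x z) × (y ≡ x))

  -- graph of p: p(x) = immediate predecessor if it exists, else x
  PRel : L → L → Set
  PRel x y = ImmSucc y x ⊎ ((∀ z → ¬ ImmSucc z x) × (y ≡ x))

  -- the substructure of (L,<,s,p) generated by a finite list G:
  -- closure of G under s and p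
  data Gen (G : List L) : L → Set where
    gen  : ∀ {x} → x ∈ G → Gen G x
    sstep : ∀ {x y} → Gen G x → SRel x y → Gen G y
    pstep : ∀ {x y} → Gen G x → PRel x y → Gen G y

  record IsIso (A B : L → Set) (R : L → L → Set) : Set where
    field
      dom        : ∀ x → A x ⇔ (∃[ y ] R x y)
      ran        : ∀ y → B y ⇔ (∃[ x ] R x y)
      functional : ∀ {x y y'} → R x y → R x y' → y ≡ y'
      injective  : ∀ {x x' y} → R x y → R x' y → x ≡ x'
      pres-<     : ∀ {x y x' y'} → R x x' → R y y' → (x < y) ⇔ (x' < y')
      pres-s     : ∀ {x y x' y'} → R x x' → R y y' → SRel x y ⇔ SRel x' y'
      pres-p     : ∀ {x y x' y'} → R x x' → R y y' → PRel x y ⇔ PRel x' y'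

  record IsAut (σ : L → L) : Set where
    field
      bijective : Bijective _≡_ _≡_ σ
      pres-<    : ∀ x y → (x < y) ⇔ (σ x < σ y)
      pres-s    : ∀ x y → SRel x y ⇔ SRel (σ x) (σ y)
      pres-p    : ∀ x y → PRel x y ⇔ PRel (σ x) (σ y)

  WeaklySpHomogeneous : Set₁
  WeaklySpHomogeneous =
    Σ (List L) λ as →
      ∀ (G G' : List L) (R : L → L → Set) →
        IsIso (Gen G) (Gen G') R →
        (∀ a → a ∈ as → R a a) →
        Σ (L → L) λ σ → IsAut σ × (∀ x y → R x y → σ x ≡ y)

Zf : (ℕ → ℕ) → Set
Zf f = Σ ℕ λ i → ℤ ⊎ Fin (f i)

data _<Z_ {f : ℕ → ℕ} : Zf f → Zf f → Set where
  lt-block : ∀ {i j u v} → i ℕ.< j → (i , u) <Z (j , v)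
  lt-zz    : ∀ {i z z'} → z ℤ.< z' → (i , inj₁ z) <Z (i , inj₁ z')
  lt-zk    : ∀ {i z k} → (i , inj₁ z) <Z (i , inj₂ k)
  lt-kk    : ∀ {i k k'} → k Fin.< k' → (i , inj₂ k) <Z (i , inj₂ k')

-- An automorphism σ of Z_f is strictly
-- monotone in both directions, and a strictly monotone self-map ρ of Z_f cannot lower blocks: ρ(ζ n 0) lies in a block ≥ n.  Indeed the images of the
-- ζ-part of block n+1 form a chain descending below ρ(ζ (n+1) 0) and staying above ρ(ζ n 0); inside a
-- single block the points above a given one are well ordered (of type ω + f(i) or finite), so the
-- chain must leave the block.  Hence no automorphism moves ζ N 0 to ζ (N+1) 0.  But given any finite
-- set of parameters, choose N beyond their blocks: the map that fixes the substructure generated by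
-- the parameters and shifts the ζ-part of block N onto that of block N+1 is an isomorphism of
-- finitely generated substructures, because s and p never leave a block and the immediate-successor
-- relation on a ζ-part does not depend on the block.
module Submission where

open import Defs
open import Data.Nat as ℕ using (ℕ; zero; suc; _⊔_; z≤n; s≤s)
import Data.Nat.Properties as ℕP
open import Data.Nat.Induction using (<-wellFounded)
open import Data.Integer as ℤ using (ℤ; +_; -[1+_]; 0ℤ; +<+; -<+; -<-)
import Data.Integer.Properties as ℤP
open import Data.Fin using (Fin; toℕ)
open import Data.Sum using (_⊎_; inj₁; inj₂)
open import Data.Product using (Σ; _×_; _,_; ∃-syntax; proj₁; proj₂)
open import Data.Product.Relation.Binary.Lex.Strict using (×-Lex; ×-wellFounded)
open import Data.List using (List; []; _∷_; _++_; [_])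
open import Data.List.Membership.Propositional using (_∈_)
open import Data.List.Membership.Propositional.Properties using (∈-++⁺ˡ; ∈-++⁺ʳ; ∈-++⁻)
open import Data.List.Relation.Unary.Any using (here; there)
open import Data.Empty using (⊥; ⊥-elim)
open import Relation.Nullary using (¬_)
open import Relation.Binary.PropositionalEquality using (_≡_; refl; sym; trans; cong; subst; subst₂)
open import Induction.WellFounded using (Acc; acc)
open import Function.Bundles using (_⇔_; mk⇔; Equivalence)

module _ (f : ℕ → ℕ) where

  private
    L : Set
    L = Zf f

    _<_ : L → L → Set
    _<_ = _<Z_ {f}

  block : L → ℕ
  block = proj₁

  ζ : ℕ → ℤ → L
  ζ i z = i , inj₁ z

  block-mono : ∀ {x y} → x < y → block x ℕ.≤ block y
  block-mono (lt-block i<j) = ℕP.<⇒≤ i<j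
  block-mono (lt-zz _)      = ℕP.≤-refl
  block-mono lt-zk          = ℕP.≤-refl
  block-mono (lt-kk _)      = ℕP.≤-refl

  ζ<ζ⁻¹ : ∀ {i a b} → ζ i a < ζ i b → a ℤ.< b
  ζ<ζ⁻¹ (lt-block i<i) = ⊥-elim (ℕP.<-irrefl refl i<i)
  ζ<ζ⁻¹ (lt-zz a<b)    = a<b

  fin≮ζ : ∀ {i a} {k : Fin (f i)} → ¬ ((i , inj₂ k) < ζ i a)
  fin≮ζ (lt-block i<i) = ℕP.<-irrefl refl i<i

  ∃-below-in-block : ∀ y → ∃[ w ] w < y × block w ≡ block y
  ∃-below-in-block (j , inj₁ a) = ζ j (ℤ.pred a) , lt-zz (ℤP.i≤pred[j]⇒i<j ℤP.≤-refl) , refl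
  ∃-below-in-block (j , inj₂ k) = ζ j 0ℤ , lt-zk , refl

  ImmSucc⇒≡block : ∀ {x y} → ImmSucc _<_ x y → block x ≡ block y
  ImmSucc⇒≡block {x} {y} (x<y , nothing-between) with ℕP.m≤n⇒m<n∨m≡n (block-mono x<y)
  ... | inj₂ eq = eq
  ... | inj₁ lt with ∃-below-in-block y
  ... | w , w<y , refl = ⊥-elim (nothing-between w (lt-block lt , w<y))

  SRel⇒≡block : ∀ {x y} → SRel _<_ x y → block y ≡ block x
  SRel⇒≡block (inj₁ x⋖y)      = sym (ImmSucc⇒≡block x⋖y)
  SRel⇒≡block (inj₂ (_ , y≡x)) = cong block y≡x

  PRel⇒≡block : ∀ {x y} → PRel _<_ x y → block y ≡ block x
  PRel⇒≡block (inj₁ y⋖x)      = ImmSucc⇒≡block y⋖x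
  PRel⇒≡block (inj₂ (_ , y≡x)) = cong block y≡x

  ImmSucc-from-ζ : ∀ {j a y} → ImmSucc _<_ (ζ j a) y → ∃[ b ] y ≡ ζ j b
  ImmSucc-from-ζ {j} {a} {_ , inj₁ b} x⋖y with ImmSucc⇒≡block x⋖y
  ... | refl = b , refl
  ImmSucc-from-ζ {j} {a} {_ , inj₂ k} x⋖y with ImmSucc⇒≡block x⋖y
  ... | refl = ⊥-elim (proj₂ x⋖y (ζ j (ℤ.suc a)) (lt-zz (ℤP.suc[i]≤j⇒i<j ℤP.≤-refl) , lt-zk))

  ImmSucc-to-ζ : ∀ {j a x} → ImmSucc _<_ x (ζ j a) → ∃[ b ] x ≡ ζ j b
  ImmSucc-to-ζ {j} {a} {_ , inj₁ b} x⋖y with ImmSucc⇒≡block x⋖y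
  ... | refl = b , refl
  ImmSucc-to-ζ {j} {a} {_ , inj₂ k} x⋖y with ImmSucc⇒≡block x⋖y
  ... | refl = ⊥-elim (fin≮ζ (proj₁ x⋖y))

  SRel-from-ζ : ∀ {j a y} → SRel _<_ (ζ j a) y → ∃[ b ] y ≡ ζ j b
  SRel-from-ζ (inj₁ x⋖y)          = ImmSucc-from-ζ x⋖y
  SRel-from-ζ {a = a} (inj₂ (_ , y≡x)) = a , y≡x

  PRel-from-ζ : ∀ {j a y} → PRel _<_ (ζ j a) y → ∃[ b ] y ≡ ζ j b
  PRel-from-ζ (inj₁ y⋖x)          = ImmSucc-to-ζ y⋖x
  PRel-from-ζ {a = a} (inj₂ (_ , y≡x)) = a , y≡x

  ImmSucc-ζ-shift : ∀ {i j a b} → ImmSucc _<_ (ζ i a) (ζ i b) → ImmSucc _<_ (ζ j a) (ζ j b)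
  ImmSucc-ζ-shift {i} {j} {a} {b} (x<y , nothing-between) = lt-zz (ζ<ζ⁻¹ x<y) , nothing-between′
    where
    nothing-between′ : ∀ w → ¬ ((ζ j a < w) × (w < ζ j b))
    nothing-between′ (_ , inj₁ c) (lt-block j<j′ , w<y) = ℕP.<⇒≱ j<j′ (block-mono w<y)
    nothing-between′ (_ , inj₁ c) (lt-zz a<c , w<y)     = nothing-between (ζ i c) (lt-zz a<c , lt-zz (ζ<ζ⁻¹ w<y))
    nothing-between′ (_ , inj₂ k) (x<w , lt-block j′<j) = ℕP.<⇒≱ j′<j (block-mono x<w)

  SRel-ζ-shift : ∀ {i j a b} → SRel _<_ (ζ i a) (ζ i b) → SRel _<_ (ζ j a) (ζ j b)
  SRel-ζ-shift (inj₁ x⋖y) = inj₁ (ImmSucc-ζ-shift x⋖y)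
  SRel-ζ-shift {i} {j} {a} (inj₂ (no-succ , refl)) = inj₂ (no-succ′ , refl)
    where
    no-succ′ : ∀ y → ¬ ImmSucc _<_ (ζ j a) y
    no-succ′ y x⋖y with ImmSucc-from-ζ x⋖y
    ... | b , refl = no-succ (ζ i b) (ImmSucc-ζ-shift x⋖y)

  PRel-ζ-shift : ∀ {i j a b} → PRel _<_ (ζ i a) (ζ i b) → PRel _<_ (ζ j a) (ζ j b)
  PRel-ζ-shift (inj₁ y⋖x) = inj₁ (ImmSucc-ζ-shift y⋖x)
  PRel-ζ-shift {i} {j} {a} (inj₂ (no-pred , refl)) = inj₂ (no-pred′ , refl)
    where
    no-pred′ : ∀ y → ¬ ImmSucc _<_ y (ζ j a)
    no-pred′ y y⋖x with ImmSucc-to-ζ y⋖x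
    ... | b , refl = no-pred (ζ i b) (ImmSucc-ζ-shift y⋖x)

  Gen-ζ-shift : ∀ {i j x} → Gen _<_ [ ζ i 0ℤ ] x → ∃[ z ] x ≡ ζ i z × Gen _<_ [ ζ j 0ℤ ] (ζ j z)
  Gen-ζ-shift (gen (here refl)) = 0ℤ , refl , gen (here refl)
  Gen-ζ-shift {i} {j} (sstep g s) with Gen-ζ-shift {i} {j} g
  ... | _ , refl , g′ with SRel-from-ζ s
  ... | b , refl = b , refl , sstep g′ (SRel-ζ-shift s)
  Gen-ζ-shift {i} {j} (pstep g p) with Gen-ζ-shift {i} {j} g
  ... | _ , refl , g′ with PRel-from-ζ p
  ... | b , refl = b , refl , pstep g′ (PRel-ζ-shift p)

  Gen-mono : ∀ {G G′} → (∀ {y} → y ∈ G → y ∈ G′) → ∀ {x} → Gen _<_ G x → Gen _<_ G′ x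
  Gen-mono G⊆G′ (gen x∈G)   = gen (G⊆G′ x∈G)
  Gen-mono G⊆G′ (sstep g s) = sstep (Gen-mono G⊆G′ g) s
  Gen-mono G⊆G′ (pstep g p) = pstep (Gen-mono G⊆G′ g) p

  Gen-++⁻ : ∀ G H {x} → Gen _<_ (G ++ H) x → Gen _<_ G x ⊎ Gen _<_ H x
  Gen-++⁻ G H (gen x∈G++H) with ∈-++⁻ G x∈G++H
  ... | inj₁ x∈G = inj₁ (gen x∈G)
  ... | inj₂ x∈H = inj₂ (gen x∈H)
  Gen-++⁻ G H (sstep g s) with Gen-++⁻ G H g
  ... | inj₁ g′ = inj₁ (sstep g′ s)
  ... | inj₂ g′ = inj₂ (sstep g′ s)
  Gen-++⁻ G H (pstep g p) with Gen-++⁻ G H g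
  ... | inj₁ g′ = inj₁ (pstep g′ p)
  ... | inj₂ g′ = inj₂ (pstep g′ p)

  maxBlock : List L → ℕ
  maxBlock []       = 0
  maxBlock (x ∷ xs) = block x ⊔ maxBlock xs

  ∈⇒block≤maxBlock : ∀ {x xs} → x ∈ xs → block x ℕ.≤ maxBlock xs
  ∈⇒block≤maxBlock {xs = y ∷ xs} (here refl) = ℕP.m≤m⊔n (block y) (maxBlock xs)
  ∈⇒block≤maxBlock {xs = y ∷ xs} (there x∈xs) =
    ℕP.≤-trans (∈⇒block≤maxBlock x∈xs) (ℕP.m≤n⊔m (block y) (maxBlock xs))

  Gen⇒block≤maxBlock : ∀ {G x} → Gen _<_ G x → block x ℕ.≤ maxBlock G
  Gen⇒block≤maxBlock (gen x∈G)   = ∈⇒block≤maxBlock x∈G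
  Gen⇒block≤maxBlock {G} (sstep g s) = subst (ℕ._≤ maxBlock G) (sym (SRel⇒≡block s)) (Gen⇒block≤maxBlock g)
  Gen⇒block≤maxBlock {G} (pstep g p) = subst (ℕ._≤ maxBlock G) (sym (PRel⇒≡block p)) (Gen⇒block≤maxBlock g)

  0<i<j⇒∣i∣<∣j∣ : ∀ {i j} → 0ℤ ℤ.< i → i ℤ.< j → ℤ.∣ i ∣ ℕ.< ℤ.∣ j ∣
  0<i<j⇒∣i∣<∣j∣ {+ _} {+ _} _ (+<+ m<n) = m<n

  ∣-∣-distance-mono : ∀ {c d d′} → c ℤ.< d → d ℤ.< d′ → ℤ.∣ d ℤ.- c ∣ ℕ.< ℤ.∣ d′ ℤ.- c ∣
  ∣-∣-distance-mono {c} {d} c<d d<d′ = 0<i<j⇒∣i∣<∣j∣ 0<d-c (ℤP.+-monoˡ-< (ℤ.- c) d<d′)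
    where
    0<d-c : 0ℤ ℤ.< d ℤ.- c
    0<d-c = subst (ℤ._< d ℤ.- c) (ℤP.+-inverseʳ c) (ℤP.+-monoˡ-< (ℤ.- c) c<d)

  private
    _<ₗₑₓ_ : ℕ × ℕ → ℕ × ℕ → Set
    _<ₗₑₓ_ = ×-Lex _≡_ ℕ._<_ ℕ._<_

  -- Ranks the points above x in x's block.  The clause for a ζ-point above a finite point is junk:
  -- that configuration cannot occur.
  rank : L → L → ℕ × ℕ
  rank (_ , inj₁ c) (_ , inj₁ d) = 0 , ℤ.∣ d ℤ.- c ∣
  rank _            (_ , inj₂ k) = 1 , toℕ k
  rank (_ , inj₂ _) (_ , inj₁ _) = 0 , 0

  rank-mono : ∀ {x w w′} → x < w → w < w′ → block w′ ℕ.≤ block x → rank x w <ₗₑₓ rank x w′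
  rank-mono (lt-block i<j) w<w′ w′≤x = ⊥-elim (ℕP.<⇒≱ i<j (ℕP.≤-trans (block-mono w<w′) w′≤x))
  rank-mono x<w (lt-block j<k) w′≤x  = ⊥-elim (ℕP.<⇒≱ j<k (ℕP.≤-trans w′≤x (block-mono x<w)))
  rank-mono (lt-zz c<d) (lt-zz d<d′) _ = inj₂ (refl , ∣-∣-distance-mono c<d d<d′)
  rank-mono (lt-zz _) lt-zk _          = inj₁ (s≤s z≤n)
  rank-mono lt-zk (lt-kk k<k′) _       = inj₂ (refl , k<k′)
  rank-mono (lt-kk _) (lt-kk k<k′) _   = inj₂ (refl , k<k′)

  no-descending-chain-in-block : (x : L) (h : ℕ → L) → (∀ n → h (suc n) < h n) → (∀ n → x < h n) →
                                 block (h 0) ℕ.≤ block x → ⊥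
  no-descending-chain-in-block x h descending above h₀≤x =
    go 0 h₀≤x (×-wellFounded <-wellFounded <-wellFounded (rank x (h 0)))
    where
    go : ∀ n → block (h n) ℕ.≤ block x → Acc _<ₗₑₓ_ (rank x (h n)) → ⊥
    go n hₙ≤x (acc rs) =
      go (suc n) (ℕP.≤-trans (block-mono (descending n)) hₙ≤x)
         (rs (rank-mono (above (suc n)) (descending n) hₙ≤x))

  module _ (ρ : L → L) (ρ-mono : ∀ {x y} → x < y → ρ x < ρ y) where

    mono⇒block-advances : ∀ n → block (ρ (ζ n 0ℤ)) ℕ.< block (ρ (ζ (suc n) 0ℤ))
    mono⇒block-advances n = ℕP.≰⇒> λ next≤this →
      no-descending-chain-in-block (ρ (ζ n 0ℤ)) (λ k → ρ (ζ (suc n) -[1+ k ]))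
        (λ k → ρ-mono (lt-zz (-<- (ℕP.n<1+n k))))
        (λ _ → ρ-mono (lt-block (ℕP.n<1+n n)))
        (ℕP.≤-trans (block-mono (ρ-mono (lt-zz -<+))) next≤this)

    mono⇒n≤block : ∀ n → n ℕ.≤ block (ρ (ζ n 0ℤ))
    mono⇒n≤block zero    = z≤n
    mono⇒n≤block (suc n) = ℕP.≤-<-trans (mono⇒n≤block n) (mono⇒block-advances n)

  IsAut⇒ζ-block-≤ : ∀ {σ x m} → IsAut _<_ σ → σ x ≡ ζ m 0ℤ → m ℕ.≤ block x
  IsAut⇒ζ-block-≤ {σ} {x} {m} aut σx≡y =
    subst (λ w → m ℕ.≤ block w) σ⁻¹y≡x (mono⇒n≤block σ⁻¹ σ⁻¹-mono m)
    where
    open IsAut aut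
    σ⁻¹ : L → L
    σ⁻¹ y = proj₁ (proj₂ bijective y)
    σσ⁻¹ : ∀ y → σ (σ⁻¹ y) ≡ y
    σσ⁻¹ y = proj₂ (proj₂ bijective y) refl
    σ⁻¹-mono : ∀ {y y′} → y < y′ → σ⁻¹ y < σ⁻¹ y′
    σ⁻¹-mono {y} {y′} y<y′ =
      Equivalence.from (pres-< (σ⁻¹ y) (σ⁻¹ y′)) (subst₂ _<_ (sym (σσ⁻¹ y)) (sym (σσ⁻¹ y′)) y<y′)
    σ⁻¹y≡x : σ⁻¹ (ζ m 0ℤ) ≡ x
    σ⁻¹y≡x = proj₁ bijective (trans (σσ⁻¹ (ζ m 0ℤ)) (sym σx≡y))

  module ShiftAbove (as : List L) where

    N : ℕ
    N = suc (maxBlock as)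

    G G′ : List L
    G  = as ++ [ ζ N 0ℤ ]
    G′ = as ++ [ ζ (suc N) 0ℤ ]

    R : L → L → Set
    R x y = (Gen _<_ as x × y ≡ x)
          ⊎ (∃[ z ] x ≡ ζ N z × y ≡ ζ (suc N) z × Gen _<_ [ ζ N 0ℤ ] x)

    fixed<N : ∀ {x} → Gen _<_ as x → block x ℕ.< N
    fixed<N g = s≤s (Gen⇒block≤maxBlock g)

    N≰fixed : ∀ {x} → Gen _<_ as x → ¬ (N ℕ.≤ block x)
    N≰fixed g = ℕP.<⇒≱ (fixed<N g)

    1+N≰fixed : ∀ {x} → Gen _<_ as x → ¬ (suc N ℕ.≤ block x)
    1+N≰fixed g 1+N≤x = N≰fixed g (ℕP.≤-trans (ℕP.n≤1+n N) 1+N≤x)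

    R-preserves-< : ∀ {x y x′ y′} → R x x′ → R y y′ → (x < y) ⇔ (x′ < y′)
    R-preserves-< (inj₁ (_ , refl)) (inj₁ (_ , refl)) = mk⇔ (λ x<y → x<y) (λ x<y → x<y)
    R-preserves-< (inj₁ (gx , refl)) (inj₂ (_ , refl , refl , _)) =
      mk⇔ (λ _ → lt-block (ℕP.m≤n⇒m≤1+n (fixed<N gx))) (λ _ → lt-block (fixed<N gx))
    R-preserves-< (inj₂ (_ , refl , refl , _)) (inj₁ (gy , refl)) =
      mk⇔ (λ x<y → ⊥-elim (N≰fixed gy (block-mono x<y))) (λ x<y → ⊥-elim (1+N≰fixed gy (block-mono x<y)))
    R-preserves-< (inj₂ (_ , refl , refl , _)) (inj₂ (_ , refl , refl , _)) =
      mk⇔ (λ x<y → lt-zz (ζ<ζ⁻¹ x<y)) (λ x<y → lt-zz (ζ<ζ⁻¹ x<y))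

    R-preserves-sameBlock : (S : L → L → Set) → (∀ {x y} → S x y → block y ≡ block x) →
                            (∀ {i j a b} → S (ζ i a) (ζ i b) → S (ζ j a) (ζ j b)) →
                            ∀ {x y x′ y′} → R x x′ → R y y′ → S x y ⇔ S x′ y′
    R-preserves-sameBlock S S⇒≡block S-shift = go
      where
      go : ∀ {x y x′ y′} → R x x′ → R y y′ → S x y ⇔ S x′ y′
      go (inj₁ (_ , refl)) (inj₁ (_ , refl)) = mk⇔ (λ s → s) (λ s → s)
      go (inj₁ (gx , refl)) (inj₂ (_ , refl , refl , _)) =
        mk⇔ (λ s → ⊥-elim (N≰fixed gx (ℕP.≤-reflexive (S⇒≡block s))))
            (λ s → ⊥-elim (1+N≰fixed gx (ℕP.≤-reflexive (S⇒≡block s))))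
      go (inj₂ (_ , refl , refl , _)) (inj₁ (gy , refl)) =
        mk⇔ (λ s → ⊥-elim (N≰fixed gy (ℕP.≤-reflexive (sym (S⇒≡block s)))))
            (λ s → ⊥-elim (1+N≰fixed gy (ℕP.≤-reflexive (sym (S⇒≡block s)))))
      go (inj₂ (_ , refl , refl , _)) (inj₂ (_ , refl , refl , _)) = mk⇔ S-shift S-shift

    R-isIso : IsIso _<_ (Gen _<_ G) (Gen _<_ G′) R
    R-isIso = record
      { dom        = λ x → mk⇔ (dom-to x) dom-from
      ; ran        = λ y → mk⇔ (ran-to y) ran-from
      ; functional = functional
      ; injective  = injective
      ; pres-<     = R-preserves-<
      ; pres-s     = R-preserves-sameBlock (SRel _<_) SRel⇒≡block SRel-ζ-shift
      ; pres-p     = R-preserves-sameBlock (PRel _<_) PRel⇒≡block PRel-ζ-shift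
      }
      where
      dom-to : ∀ x → Gen _<_ G x → ∃[ y ] R x y
      dom-to x g with Gen-++⁻ as [ ζ N 0ℤ ] g
      ... | inj₁ g-as = x , inj₁ (g-as , refl)
      ... | inj₂ g-N with Gen-ζ-shift {N} {N} g-N
      ... | z , refl , _ = ζ (suc N) z , inj₂ (z , refl , refl , g-N)

      dom-from : ∀ {x} → ∃[ y ] R x y → Gen _<_ G x
      dom-from (_ , inj₁ (g-as , _))         = Gen-mono ∈-++⁺ˡ g-as
      dom-from (_ , inj₂ (_ , _ , _ , g-N)) = Gen-mono (∈-++⁺ʳ as) g-N

      ran-to : ∀ y → Gen _<_ G′ y → ∃[ x ] R x y
      ran-to y g with Gen-++⁻ as [ ζ (suc N) 0ℤ ] g
      ... | inj₁ g-as = y , inj₁ (g-as , refl)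
      ... | inj₂ g-1+N with Gen-ζ-shift {suc N} {N} g-1+N
      ... | z , refl , g-N = ζ N z , inj₂ (z , refl , refl , g-N)

      ran-from : ∀ {y} → ∃[ x ] R x y → Gen _<_ G′ y
      ran-from (_ , inj₁ (g-as , refl)) = Gen-mono ∈-++⁺ˡ g-as
      ran-from (_ , inj₂ (_ , refl , refl , g-N)) with Gen-ζ-shift {N} {suc N} g-N
      ... | _ , refl , g-1+N = Gen-mono (∈-++⁺ʳ as) g-1+N

      functional : ∀ {x y y′} → R x y → R x y′ → y ≡ y′
      functional (inj₁ (_ , refl)) (inj₁ (_ , refl))                         = refl
      functional (inj₁ (g , _)) (inj₂ (_ , refl , _ , _))                     = ⊥-elim (N≰fixed g ℕP.≤-refl)
      functional (inj₂ (_ , refl , _ , _)) (inj₁ (g , _))                     = ⊥-elim (N≰fixed g ℕP.≤-refl)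
      functional (inj₂ (_ , refl , refl , _)) (inj₂ (_ , refl , refl , _))   = refl

      injective : ∀ {x x′ y} → R x y → R x′ y → x ≡ x′
      injective (inj₁ (_ , refl)) (inj₁ (_ , refl))                          = refl
      injective (inj₁ (g , refl)) (inj₂ (_ , refl , refl , _))               = ⊥-elim (1+N≰fixed g ℕP.≤-refl)
      injective (inj₂ (_ , refl , refl , _)) (inj₁ (g , refl))               = ⊥-elim (1+N≰fixed g ℕP.≤-refl)
      injective (inj₂ (_ , refl , refl , _)) (inj₂ (_ , refl , refl , _))    = refl

    R-fixes-parameters : ∀ a → a ∈ as → R a a
    R-fixes-parameters _ a∈as = inj₁ (gen a∈as , refl)

    R-shifts-ζN0 : R (ζ N 0ℤ) (ζ (suc N) 0ℤ)
    R-shifts-ζN0 = inj₂ (0ℤ , refl , refl , gen (here refl))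

    R-has-no-extension : ¬ (Σ (L → L) λ σ → IsAut _<_ σ × (∀ x y → R x y → σ x ≡ y))
    R-has-no-extension (_ , σ-aut , σ-extends-R) =
      ℕP.<-irrefl refl (IsAut⇒ζ-block-≤ σ-aut (σ-extends-R _ _ R-shifts-ζN0))

mainTheorem13 : (f : ℕ → ℕ) → ¬ WeaklySpHomogeneous (_<Z_ {f})
mainTheorem13 f (as , extend) = R-has-no-extension (extend G G′ R R-isIso R-fixes-parameters)
  where open ShiftAbove f as
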